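{- Let $D$ be an orientation of a graph $G$, and let $\eta$ be the index function of $G$ defined by $\eta(v)=d^+_D(v)$ for every vertex $v$ and $\eta(e)=1$ for every edge $e$. Then $\eta$ is a non-singular index function of $G$.
   Context: Graphs are finite and simple; $d^+_D(v)$ is the out-degree of $v$ in $D$; $E(v)$ is the set of edges incident to $v$. Fix any orientation $D_0$ of $G$ and a variable $x_z$ for every $z\in V(G)\cup E(G)$, and let $$P_G=\prod_{(u,v)\in E(D_0)}\Big(\big(\textstyle\sum_{e\in E(u)}x_e+x_u\big)-\big(\sum_{e\in E(v)}x_e+x_v\big)\Big).$$ An index function of $G$ is a map $\eta: V(G)\cup E(G)\to\{0,1,2,\dots\}$; it is valid if $\sum_z\eta(z)=|E(G)|$. For valid $\eta$, $c_\eta$ is the coefficient of $\prod_z x_z^{\eta(z)}$ in $P_G$. An index function $\eta$ is non-singular if there is a valid index function $\eta'\le\eta$ (pointwise) with $c_{\eta'}\neq 0$ (independent of the choice of $D_0$). -}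

module Defs where

open import Data.Nat as ℕ using (ℕ; zero; suc; _≤_)
open import Data.Integer as ℤ using (ℤ; 0ℤ; 1ℤ)
open import Data.Bool using (Bool; true; false; if_then_else_)
open import Data.Fin using (Fin; splitAt; _↑ˡ_; _↑ʳ_)
open import Data.Fin.Properties using () renaming (_≟_ to _≟ᶠ_)
open import Data.List using (List; []; _∷_; map; filter; concatMap; length; foldr; _++_; allFin)
open import Data.Vec using (Vec; tabulate; zipWith; replicate)
open import Data.Vec.Properties using (≡-dec)
open import Data.Product using (_×_; _,_; proj₁; proj₂)
open import Data.Sum using (_⊎_; inj₁; inj₂)
open import Relation.Nullary using (¬_; Dec; yes; no)
open import Relation.Binary.PropositionalEquality using (_≡_; _≢_)
import Data.Nat.Properties as ℕP
open import Data.Nat.ListAction using (sum)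
open import Data.Product using (Σ)

record Graph : Set where
  field
    n     : ℕ
    m     : ℕ
    ends  : Fin m → Fin n × Fin n
    loopless : ∀ e → proj₁ (ends e) ≢ proj₂ (ends e)
    simple   : ∀ e f →
      ((proj₁ (ends e) ≡ proj₁ (ends f)) × (proj₂ (ends e) ≡ proj₂ (ends f)))
      ⊎ ((proj₁ (ends e) ≡ proj₂ (ends f)) × (proj₂ (ends e) ≡ proj₁ (ends f)))
      → e ≡ f

open Graph public

Vertex : Graph → Set
Vertex G = Fin (n G)

Edge : Graph → Set
Edge G = Fin (m G)

Elem : Graph → Set
Elem G = Vertex G ⊎ Edge G

incident? : (G : Graph) (v : Vertex G) (e : Edge G) → Dec (v ≡ proj₁ (ends G e) ⊎ v ≡ proj₂ (ends G e))
incident? G v e with v ≟ᶠ proj₁ (ends G e) | v ≟ᶠ proj₂ (ends G e)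
... | yes p | _ = yes (inj₁ p)
... | no _ | yes q = yes (inj₂ q)
... | no ¬p | no ¬q = no λ { (inj₁ p) → ¬p p ; (inj₂ q) → ¬q q }

E : (G : Graph) → Vertex G → List (Edge G)
E G v = filter (incident? G v) (allFin (m G))

-- Orientations: for each edge, a Bool saying whether it is reversed
-- relative to the stored pair (false: proj₁ → proj₂, true: proj₂ → proj₁).

Orientation : Graph → Set
Orientation G = Edge G → Bool

tail head : (G : Graph) → Orientation G → Edge G → Vertex G
tail G D e = if D e then proj₂ (ends G e) else proj₁ (ends G e)
head G D e = if D e then proj₁ (ends G e) else proj₂ (ends G e)

outdeg : (G : Graph) → Orientation G → Vertex G → ℕ
outdeg G D v = length (filter (λ e → v ≟ᶠ tail G D e) (allFin (m G)))

D₀ : (G : Graph) → Orientation G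
D₀ G _ = false

-- Multivariate polynomials over ℤ in k variables, as finite formal sums
-- of terms (coefficient, exponent vector).

Monomial : ℕ → Set
Monomial k = Vec ℕ k

Poly : ℕ → Set
Poly k = List (ℤ × Monomial k)

var : ∀ {k} → Fin k → Poly k
var {k} i = (1ℤ , tabulate (λ j → if isYes (i ≟ᶠ j) then 1 else 0)) ∷ []
  where
  isYes : ∀ {A : Set} → Dec A → Bool
  isYes (yes _) = true
  isYes (no _)  = false

const1 : ∀ {k} → Poly k
const1 {k} = (1ℤ , replicate k 0) ∷ []

zeroP : ∀ {k} → Poly k
zeroP = []

_+P_ : ∀ {k} → Poly k → Poly k → Poly k
p +P q = p ++ q

-P_ : ∀ {k} → Poly k → Poly k
-P p = map (λ { (c , μ) → (ℤ.- c , μ) }) p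

_-P_ : ∀ {k} → Poly k → Poly k → Poly k
p -P q = p +P (-P q)

_*P_ : ∀ {k} → Poly k → Poly k → Poly k
p *P q = concatMap (λ { (c , μ) → map (λ { (d , ν) → (c ℤ.* d , zipWith ℕ._+_ μ ν) }) q }) p

sumP : ∀ {k} → List (Poly k) → Poly k
sumP = foldr _+P_ zeroP

prodP : ∀ {k} → List (Poly k) → Poly k
prodP = foldr _*P_ const1

coeff : ∀ {k} → Poly k → Monomial k → ℤ
coeff [] μ = 0ℤ
coeff ((c , ν) ∷ p) μ with ≡-dec ℕP._≟_ ν μ
... | yes _ = c ℤ.+ coeff p μ
... | no _  = coeff p μ

NVars : Graph → ℕ
NVars G = n G ℕ.+ m G

xV : (G : Graph) → Vertex G → Poly (NVars G)
xV G v = var (v ↑ˡ m G)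

xE : (G : Graph) → Edge G → Poly (NVars G)
xE G e = var (n G ↑ʳ e)

L : (G : Graph) → Vertex G → Poly (NVars G)
L G v = sumP (map (xE G) (E G v)) +P xV G v

P : (G : Graph) → Poly (NVars G)
P G = prodP (map (λ e → L G (tail G (D₀ G) e) -P L G (head G (D₀ G) e)) (allFin (m G)))

IndexFunction : Graph → Set
IndexFunction G = Elem G → ℕ

total : (G : Graph) → IndexFunction G → ℕ
total G η = sum (map (λ v → η (inj₁ v)) (allFin (n G)))
        ℕ.+ sum (map (λ e → η (inj₂ e)) (allFin (m G)))

Valid : (G : Graph) → IndexFunction G → Set
Valid G η = total G η ≡ m G

monomial : (G : Graph) → IndexFunction G → Monomial (NVars G)
monomial G η = tabulate (λ i → η (splitAt (n G) i))

c : (G : Graph) → IndexFunction G → ℤ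
c G η = coeff (P G) (monomial G η)

_≤ᶠ_ : {G : Graph} → IndexFunction G → IndexFunction G → Set
_≤ᶠ_ {G} η' η = ∀ (z : Elem G) → η' z ≤ η z

NonSingular : (G : Graph) → IndexFunction G → Set
NonSingular G η = Σ (IndexFunction G) (λ η' → (_≤ᶠ_ {G} η' η) × Valid G η' × (c G η' ≢ 0ℤ))

ηD : (G : Graph) → Orientation G → IndexFunction G
ηD G D (inj₁ v) = outdeg G D v
ηD G D (inj₂ e) = 1

-- P_G is the product over the edges f of the linear forms ℓ_f = L(end₁ f) − L(end₂ f).  Weighting every
-- variable by its index, the edge variables are heavier than the vertex variables, so each ℓ_f has a
-- unique lightest variable x_w, w the endpoint of f with smaller index; hence the monomial choosing
-- that endpoint in every factor has coefficient ±1.  For an edge e = uv every ℓ_f satisfies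
-- [x_e]ℓ_f = [x_u]ℓ_f + [x_v]ℓ_f, so by the Leibniz rule ∂_e P_G = ∂_u P_G + ∂_v P_G.  Comparing
-- coefficients, if x_v·b has a nonzero coefficient then so has x_e·b or x_u·b.  Walking through
-- the edges, every factor that chose the head of its edge is moved to the edge variable or the tail
-- without losing nonvanishing.  The resulting monomial has exponent at most 1 on each edge and
-- at most d⁺_D(v) on each vertex v, as required.

module Submission where

open import Defs
open import Data.Nat as ℕ using (ℕ; zero; suc; _≤_; _<_; s≤s)
import Data.Nat.Properties as ℕP
open import Data.Nat.ListAction using () renaming (sum to ListSum)
open import Data.Integer as ℤ using (ℤ; 0ℤ; 1ℤ; -_; _+_; _*_)
import Data.Integer.Properties as ℤP
open import Data.Integer.Tactic.RingSolver using (solve-∀)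
open import Data.Fin as F using (Fin; zero; suc; toℕ; _↑ˡ_; _↑ʳ_)
open import Data.Fin.Properties using (_≟_)
import Data.Fin.Properties as FP
open import Data.List as L using (List; []; _∷_; map; filter; allFin)
import Data.List.Properties as LP
open import Data.List.Membership.Propositional using (_∈_)
open import Data.List.Relation.Unary.Any using (here; there)
open import Data.List.Relation.Unary.All as All using (All; []; _∷_)
open import Data.List.Relation.Unary.Unique.Propositional using (Unique; []; _∷_)
import Data.List.Relation.Unary.Unique.Propositional.Properties as UniqueP
import Data.List.Relation.Unary.All.Properties as AllP
open import Data.List.Membership.Propositional.Properties using (∈-filter⁺; ∈-allFin)
open import Data.Vec as V using (Vec; _∷_; lookup; replicate; updateAt; zipWith)
import Data.Vec.Properties as VP
open import Data.Vec.Properties using (≡-dec)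
open import Data.Product using (Σ; _×_; _,_; proj₁; proj₂; map₁; map₂)
open import Data.Sum using (_⊎_; inj₁; inj₂; [_,_]′)
import Data.Sum as Sum
open import Data.Bool using (true; false)
open import Function using (_∘_; const)
open import Data.Vec.Functional as VF using (Vector)
import Data.Vec.Functional.Properties as VFP
open import Function.Bundles using (_⇔_; mk⇔; Equivalence)
open import Relation.Nullary using (¬_; yes; no; ¬?; contradiction)
open import Relation.Unary using (Pred; Decidable)
open import Level using (0ℓ)
open import Relation.Binary.PropositionalEquality
open import Algebra.Properties.CommutativeSemigroup ℕP.+-commutativeSemigroup using (x∙yz≈y∙xz)

private variable
  k : ℕ
  i j : Fin k
  μ ν : Monomial k

one : Monomial k
one = replicate _ 0

inc dec : Fin k → Monomial k → Monomial k
inc i μ = updateAt μ i suc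
dec i μ = updateAt μ i ℕ.pred

monomialOf : List (Fin k) → Monomial k
monomialOf = L.foldr inc one

dec-inc : ∀ i (μ : Monomial k) → dec i (inc i μ) ≡ μ
dec-inc i μ = trans (VP.updateAt-updateAt i μ) (VP.updateAt-id-local i μ refl)

inc-dec : ∀ i {t} (μ : Monomial k) → lookup μ i ≡ suc t → inc i (dec i μ) ≡ μ
inc-dec i μ μi≡1+t = trans (VP.updateAt-updateAt i μ)
  (VP.updateAt-id-local i μ (trans (cong (λ x → suc (ℕ.pred x)) μi≡1+t) (sym μi≡1+t)))

dec-inc-comm : i ≢ j → ∀ (μ : Monomial k) → dec i (inc j μ) ≡ inc j (dec i μ)
dec-inc-comm {i = i} {j} i≢j = VP.updateAt-commutes i j i≢j

inc-comm : ∀ (i j : Fin k) μ → inc i (inc j μ) ≡ inc j (inc i μ)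
inc-comm i j μ with i ≟ j
... | yes refl = refl
... | no i≢j   = VP.updateAt-commutes i j i≢j μ

zipWith-inc-one : ∀ i (ν : Monomial k) → zipWith ℕ._+_ (inc i one) ν ≡ inc i ν
zipWith-inc-one zero    (x ∷ ν) = cong (suc x ∷_) (VP.zipWith-identityˡ ℕP.+-identityˡ ν)
zipWith-inc-one (suc i) (x ∷ ν) = cong (x ∷_) (zipWith-inc-one i ν)

inc≢ : lookup μ i ≡ 0 → inc i ν ≢ μ
inc≢ {μ = μ} {i} {ν} μi≡0 inc≡μ =
  ℕP.1+n≢0 (trans (sym (VP.lookup∘updateAt i ν)) (trans (cong (λ ρ → lookup ρ i) inc≡μ) μi≡0))

inc≡⇔≡dec : ∀ {t} → lookup μ i ≡ suc t → (inc i ν ≡ μ) ⇔ (ν ≡ dec i μ)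
inc≡⇔≡dec {μ = μ} {i} {ν} μi≡1+t = mk⇔
  (λ inc≡μ → trans (sym (dec-inc i ν)) (cong (dec i) inc≡μ))
  (λ ν≡dec → trans (cong (inc i) ν≡dec) (inc-dec i μ μi≡1+t))

lookup-inc-≤ : ∀ (i j : Fin k) μ → lookup (inc i μ) j ≤ suc (lookup μ j)
lookup-inc-≤ i j μ with i ≟ j
... | yes refl = ℕP.≤-reflexive (VP.lookup∘updateAt i μ)
... | no i≢j   = ℕP.≤-trans (ℕP.≤-reflexive (VP.lookup∘updateAt′ j i (i≢j ∘ sym) μ)) (ℕP.n≤1+n _)

sum-inc : ∀ i (μ : Monomial k) → V.sum (inc i μ) ≡ suc (V.sum μ)
sum-inc zero    (x ∷ μ) = refl
sum-inc (suc i) (x ∷ μ) = trans (cong (x ℕ.+_) (sum-inc i μ)) (ℕP.+-suc x _)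

sum-monomialOf : ∀ (is : List (Fin k)) → V.sum (monomialOf is) ≡ L.length is
sum-monomialOf {k} []       = sum-one k
  where
  sum-one : ∀ k → V.sum (one {k}) ≡ 0
  sum-one zero    = refl
  sum-one (suc k) = sum-one k
sum-monomialOf (i ∷ is) = trans (sum-inc i (monomialOf is)) (cong suc (sum-monomialOf is))

sum-lookup-allFin : ∀ {p} (xs : Vec ℕ p) → ListSum (map (lookup xs) (allFin p)) ≡ V.sum xs
sum-lookup-allFin V.[]    = refl
sum-lookup-allFin (x ∷ xs) = cong (x ℕ.+_) (trans
  (cong ListSum (trans (LP.map-tabulate suc (lookup (x ∷ xs))) (sym (LP.map-tabulate (λ i → i) (lookup xs)))))
  (sum-lookup-allFin xs))

sum-split : ∀ p {q} (μ : Vec ℕ (p ℕ.+ q)) →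
            ListSum (map (λ i → lookup μ (i ↑ˡ q)) (allFin p)) ℕ.+ ListSum (map (λ j → lookup μ (p ↑ʳ j)) (allFin q))
            ≡ V.sum μ
sum-split p {q} μ = subst (λ ν → Split ν ≡ V.sum ν) (VP.take++drop≡id p μ) (split-++ (V.take p μ) (V.drop p μ))
  where
  Split : Vec ℕ (p ℕ.+ q) → ℕ
  Split ν = ListSum (map (λ i → lookup ν (i ↑ˡ q)) (allFin p)) ℕ.+ ListSum (map (λ j → lookup ν (p ↑ʳ j)) (allFin q))
  split-++ : ∀ xs ys → Split (xs V.++ ys) ≡ V.sum (xs V.++ ys)
  split-++ xs ys = begin
    Split (xs V.++ ys)
      ≡⟨ cong₂ (λ l r → ListSum l ℕ.+ ListSum r) (LP.map-cong (VP.lookup-++ˡ xs ys) (allFin p))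
                                                  (LP.map-cong (VP.lookup-++ʳ xs ys) (allFin q)) ⟩
    ListSum (map (lookup xs) (allFin p)) ℕ.+ ListSum (map (lookup ys) (allFin q))
      ≡⟨ cong₂ ℕ._+_ (sum-lookup-allFin xs) (sum-lookup-allFin ys) ⟩
    V.sum xs ℕ.+ V.sum ys
      ≡⟨ VP.sum-++ xs ⟨
    V.sum (xs V.++ ys) ∎
    where open ≡-Reasoning

weight : (Fin k → ℕ) → Monomial k → ℕ
weight ω V.[]    = 0
weight ω (x ∷ μ) = ω zero ℕ.* x ℕ.+ weight (ω ∘ suc) μ

weight-one : ∀ (ω : Fin k → ℕ) → weight ω one ≡ 0
weight-one {zero}  ω = refl
weight-one {suc k} ω = trans (cong (ℕ._+ weight (ω ∘ suc) one) (ℕP.*-zeroʳ (ω zero))) (weight-one (ω ∘ suc))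

weight-inc : ∀ (ω : Fin k → ℕ) i μ → weight ω (inc i μ) ≡ ω i ℕ.+ weight ω μ
weight-inc ω zero    (x ∷ μ) =
  trans (cong (ℕ._+ weight (ω ∘ suc) μ) (ℕP.*-suc (ω zero) x)) (ℕP.+-assoc (ω zero) (ω zero ℕ.* x) _)
weight-inc ω (suc i) (x ∷ μ) =
  trans (cong (ω zero ℕ.* x ℕ.+_) (weight-inc (ω ∘ suc) i μ)) (x∙yz≈y∙xz (ω zero ℕ.* x) (ω (suc i)) _)

module _ {r : ℕ} (c : Fin r → Fin k) where

  lookup-monomialOf-≡0 : ∀ {xs} → All (λ x → c x ≢ i) xs → lookup (monomialOf (map c xs)) i ≡ 0
  lookup-monomialOf-≡0 {i = i} []                 = VP.lookup-replicate i 0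
  lookup-monomialOf-≡0 {i = i} {x ∷ xs} (cx≢i ∷ ps) =
    trans (VP.lookup∘updateAt′ i (c x) (cx≢i ∘ sym) (monomialOf (map c xs))) (lookup-monomialOf-≡0 ps)

  lookup-monomialOf-≤ : ∀ {P : Pred (Fin r) 0ℓ} (P? : Decidable P) → (∀ x → c x ≡ i → P x) →
                        ∀ xs → lookup (monomialOf (map c xs)) i ≤ L.length (filter P? xs)
  lookup-monomialOf-≤ {i = i} P? sel⇒P []       = ℕP.≤-reflexive (VP.lookup-replicate i 0)
  lookup-monomialOf-≤ {i = i} P? sel⇒P (x ∷ xs) with c x ≟ i
  ... | yes refl = begin
    lookup (inc (c x) (monomialOf (map c xs))) (c x) ≡⟨ VP.lookup∘updateAt (c x) (monomialOf (map c xs)) ⟩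
    suc (lookup (monomialOf (map c xs)) (c x))       ≤⟨ s≤s (lookup-monomialOf-≤ P? sel⇒P xs) ⟩
    suc (L.length (filter P? xs))                     ≡⟨ cong L.length (LP.filter-accept P? (sel⇒P x refl)) ⟨
    L.length (filter P? (x ∷ xs))                     ∎
    where open ℕP.≤-Reasoning
  ... | no cx≢i = begin
    lookup (inc (c x) (monomialOf (map c xs))) i ≡⟨ VP.lookup∘updateAt′ i (c x) (cx≢i ∘ sym) (monomialOf (map c xs)) ⟩
    lookup (monomialOf (map c xs)) i             ≤⟨ lookup-monomialOf-≤ P? sel⇒P xs ⟩
    L.length (filter P? xs)                       ≤⟨ length-filter-∷ ⟩
    L.length (filter P? (x ∷ xs))                 ∎
    where
    open ℕP.≤-Reasoning
    length-filter-∷ : L.length (filter P? xs) ≤ L.length (filter P? (x ∷ xs))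
    length-filter-∷ with P? x
    ... | yes _ = ℕP.n≤1+n _
    ... | no _  = ℕP.≤-refl

without : Fin k → List (Fin k) → List (Fin k)
without e = filter (λ x → ¬? (x ≟ e))

monomialOf-focus : ∀ {r} {xs : List (Fin r)} {e} (c c′ : Fin r → Fin k) → Unique xs → e ∈ xs →
                   (∀ x → x ≢ e → c′ x ≡ c x) →
                   monomialOf (map c′ xs) ≡ inc (c′ e) (monomialOf (map c (without e xs)))
monomialOf-focus {xs = x ∷ xs} {e} c c′ (x∉xs ∷ unique) e∈ agree with x ≟ e
... | yes refl = cong (inc (c′ x) ∘ monomialOf) (begin
  map c′ xs                 ≡⟨ LP.map-cong-local (All.map (λ x≢y → agree _ (x≢y ∘ sym)) x∉xs) ⟩
  map c xs                  ≡⟨ cong (map c) (LP.filter-all _ (All.map (λ x≢y → x≢y ∘ sym) x∉xs)) ⟨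
  map c (without x xs)      ∎)
  where open ≡-Reasoning
... | no x≢e = begin
  inc (c′ x) (monomialOf (map c′ xs))
    ≡⟨ cong₂ inc (agree x x≢e) (monomialOf-focus c c′ unique (e∈xs e∈) agree) ⟩
  inc (c x) (inc (c′ e) (monomialOf (map c (without e xs))))  ≡⟨ inc-comm (c x) (c′ e) _ ⟩
  inc (c′ e) (inc (c x) (monomialOf (map c (without e xs))))  ∎
  where
  open ≡-Reasoning
  e∈xs : e ∈ x ∷ xs → e ∈ xs
  e∈xs (here e≡x)   = contradiction (sym e≡x) x≢e
  e∈xs (there e∈xs) = e∈xs

-- Coefficients of products with linear forms

Coefficients : ℕ → Set
Coefficients k = Monomial k → ℤ

coeff-++ : ∀ (p q : Poly k) μ → coeff (p L.++ q) μ ≡ coeff p μ + coeff q μ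
coeff-++ []            q μ = sym (ℤP.+-identityˡ _)
coeff-++ ((c , ν) ∷ p) q μ with ≡-dec ℕP._≟_ ν μ
... | yes _ = trans (cong (c +_) (coeff-++ p q μ)) (sym (ℤP.+-assoc c _ _))
... | no _  = coeff-++ p q μ

*P-distribʳ-++ : ∀ (p q r : Poly k) → (p L.++ q) *P r ≡ (p *P r) L.++ (q *P r)
*P-distribʳ-++ p q r = trans (cong L.concat (LP.map-++ _ p q)) (sym (LP.concat-++ (map _ p) (map _ q)))

-- var tabulates its exponent vector through a helper local to its definition; unification names
-- the tabulated function in `tabulated`.
var≡ : ∀ {k} (i : Fin k) → var i ≡ (1ℤ , inc i one) ∷ []
var≡ {k} i = trans (proj₂ tabulated)
  (cong (λ ν → (1ℤ , ν) ∷ []) (trans (VP.tabulate-cong exponent) (VP.tabulate∘lookup (inc i one))))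
  where
  tabulated : Σ (Fin k → ℕ) λ f → var i ≡ (1ℤ , V.tabulate f) ∷ []
  tabulated = _ , refl
  exponent : ∀ j → proj₁ tabulated j ≡ lookup (inc i one) j
  exponent j with i ≟ j
  ... | yes refl = sym (trans (VP.lookup∘updateAt i one) (cong suc (VP.lookup-replicate i 0)))
  ... | no i≢j   = sym (trans (VP.lookup∘updateAt′ j i (i≢j ∘ sym) one) (VP.lookup-replicate j 0))

module _ (c : ℤ) (u : Monomial k) where

  coeff-term-*P-≢ : ∀ {μ} → (∀ ν → zipWith ℕ._+_ u ν ≢ μ) → ∀ Q → coeff (((c , u) ∷ []) *P Q) μ ≡ 0ℤ
  coeff-term-*P-≢ ≢μ []            = refl
  coeff-term-*P-≢ {μ} ≢μ ((d , ν) ∷ Q) with ≡-dec ℕP._≟_ (zipWith ℕ._+_ u ν) μ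
  ... | yes eq = contradiction eq (≢μ ν)
  ... | no _   = coeff-term-*P-≢ ≢μ Q

  coeff-term-*P-≡ : ∀ {μ μ′} → (∀ ν → (zipWith ℕ._+_ u ν ≡ μ) ⇔ (ν ≡ μ′)) → ∀ Q →
                    coeff (((c , u) ∷ []) *P Q) μ ≡ c * coeff Q μ′
  coeff-term-*P-≡ ⇔μ′ [] = sym (ℤP.*-zeroʳ c)
  coeff-term-*P-≡ {μ} {μ′} ⇔μ′ ((d , ν) ∷ Q)
    with ≡-dec ℕP._≟_ (zipWith ℕ._+_ u ν) μ | ≡-dec ℕP._≟_ ν μ′
  ... | yes _  | yes _  = trans (cong (c * d +_) (coeff-term-*P-≡ ⇔μ′ Q)) (sym (ℤP.*-distribˡ-+ c d _))
  ... | yes eq | no ≢μ′ = contradiction (Equivalence.to (⇔μ′ ν) eq) ≢μ′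
  ... | no ≢μ  | yes eq = contradiction (Equivalence.from (⇔μ′ ν) eq) ≢μ
  ... | no _   | no _   = coeff-term-*P-≡ ⇔μ′ Q

ifPositive : ℕ → ℤ → ℤ
ifPositive zero    _ = 0ℤ
ifPositive (suc _) z = z

ifPositive-+ : ∀ n x y → ifPositive n (x + y) ≡ ifPositive n x + ifPositive n y
ifPositive-+ zero    _ _ = refl
ifPositive-+ (suc _) _ _ = refl

-- If C is the coefficient function of f, then mulVar i C and ∂ i C are those of xᵢ·f and ∂f/∂xᵢ;
-- the guard in mulVar is needed because dec truncates at exponent 0.
mulVar : Fin k → Coefficients k → Coefficients k
mulVar i C μ = ifPositive (lookup μ i) (C (dec i μ))

∂ : Fin k → Coefficients k → Coefficients k
∂ i C μ = ℤ.+ suc (lookup μ i) * C (inc i μ)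

mulVar-zero : ∀ i C (μ : Monomial k) → lookup μ i ≡ 0 → mulVar i C μ ≡ 0ℤ
mulVar-zero i C μ μi≡0 = cong (λ n → ifPositive n (C (dec i μ))) μi≡0

mulVar-suc : ∀ i C (μ : Monomial k) {t} → lookup μ i ≡ suc t → mulVar i C μ ≡ C (dec i μ)
mulVar-suc i C μ μi≡1+t = cong (λ n → ifPositive n (C (dec i μ))) μi≡1+t

coeff-term-*P : ∀ c i (Q : Poly k) μ → coeff (((c , inc i one) ∷ []) *P Q) μ ≡ c * mulVar i (coeff Q) μ
coeff-term-*P c i Q μ with lookup μ i in μi
... | zero  = trans (coeff-term-*P-≢ c (inc i one) shift≢ Q) (sym (ℤP.*-zeroʳ c))
  where
  shift≢ : ∀ ν → zipWith ℕ._+_ (inc i one) ν ≢ μ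
  shift≢ ν eq = inc≢ μi (trans (sym (zipWith-inc-one i ν)) eq)
... | suc t = coeff-term-*P-≡ c (inc i one) shift⇔ Q
  where
  shift⇔ : ∀ ν → (zipWith ℕ._+_ (inc i one) ν ≡ μ) ⇔ (ν ≡ dec i μ)
  shift⇔ ν = mk⇔ (Equivalence.to (inc≡⇔≡dec μi) ∘ trans (sym (zipWith-inc-one i ν)))
                 (trans (zipWith-inc-one i ν) ∘ Equivalence.from (inc≡⇔≡dec μi))

∂-mulVar-≢ : i ≢ j → ∀ C μ → ∂ j (mulVar i C) μ ≡ mulVar i (∂ j C) μ
∂-mulVar-≢ {i = i} {j} i≢j C μ with lookup μ i in μi
... | zero  = trans (cong (ℤ.+ suc (lookup μ j) *_) (mulVar-zero i C (inc j μ) μi′)) (ℤP.*-zeroʳ (ℤ.+ suc (lookup μ j)))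
  where
  μi′ : lookup (inc j μ) i ≡ 0
  μi′ = trans (VP.lookup∘updateAt′ i j i≢j μ) μi
... | suc t = begin
  ℤ.+ suc (lookup μ j) * mulVar i C (inc j μ)            ≡⟨ cong (ℤ.+ suc (lookup μ j) *_) (mulVar-suc i C (inc j μ) μi′) ⟩
  ℤ.+ suc (lookup μ j) * C (dec i (inc j μ))
    ≡⟨ cong₂ (λ n ν → ℤ.+ suc n * C ν) (sym (VP.lookup∘updateAt′ j i (i≢j ∘ sym) μ)) (dec-inc-comm i≢j μ) ⟩
  ℤ.+ suc (lookup (dec i μ) j) * C (inc j (dec i μ))     ∎
  where
  open ≡-Reasoning
  μi′ : lookup (inc j μ) i ≡ suc t
  μi′ = trans (VP.lookup∘updateAt′ i j i≢j μ) μi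

∂-mulVar-≡ : ∀ i C (μ : Monomial k) → ∂ i (mulVar i C) μ ≡ mulVar i (∂ i C) μ + C μ
∂-mulVar-≡ i C μ = trans ∂x·C≡ (sym (x·∂C+C≡ (lookup μ i) refl))
  where
  ∂x·C≡ : ∂ i (mulVar i C) μ ≡ ℤ.+ suc (lookup μ i) * C μ
  ∂x·C≡ = cong (ℤ.+ suc (lookup μ i) *_)
    (trans (mulVar-suc i C (inc i μ) (VP.lookup∘updateAt i μ)) (cong C (dec-inc i μ)))
  x·∂C+C≡ : ∀ n → lookup μ i ≡ n → mulVar i (∂ i C) μ + C μ ≡ ℤ.+ suc n * C μ
  x·∂C+C≡ zero    μi = begin
    mulVar i (∂ i C) μ + C μ ≡⟨ cong (_+ C μ) (mulVar-zero i (∂ i C) μ μi) ⟩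
    0ℤ + C μ                 ≡⟨ ℤP.+-identityˡ (C μ) ⟩
    C μ                      ≡⟨ ℤP.*-identityˡ (C μ) ⟨
    1ℤ * C μ                 ∎
    where open ≡-Reasoning
  x·∂C+C≡ (suc t) μi = begin
    mulVar i (∂ i C) μ + C μ                           ≡⟨ cong (_+ C μ) (mulVar-suc i (∂ i C) μ μi) ⟩
    ℤ.+ suc (lookup (dec i μ) i) * C (inc i (dec i μ)) + C μ
      ≡⟨ cong₂ (λ n ν → ℤ.+ suc n * C ν + C μ) (trans (VP.lookup∘updateAt i μ) (cong ℕ.pred μi)) (inc-dec i μ μi) ⟩
    ℤ.+ suc t * C μ + C μ                              ≡⟨ a*c+c≡[1+a]*c (ℤ.+ suc t) (C μ) ⟩
    (1ℤ + ℤ.+ suc t) * C μ                             ≡⟨ cong (_* C μ) (ℤP.pos-+ 1 (suc t)) ⟨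
    ℤ.+ suc (suc t) * C μ                             ∎
    where
    open ≡-Reasoning
    a*c+c≡[1+a]*c : ∀ a c → a * c + c ≡ (1ℤ + a) * c
    a*c+c≡[1+a]*c = solve-∀

LinearForm : ℕ → Set
LinearForm k = List (ℤ × Fin k)

⟦_⟧ : LinearForm k → Poly k
⟦_⟧ = map (map₂ (λ i → inc i one))

neg : LinearForm k → LinearForm k
neg = map (map₁ (-_))

⟦neg⟧ : ∀ (ℓ : LinearForm k) → -P ⟦ ℓ ⟧ ≡ ⟦ neg ℓ ⟧
⟦neg⟧ ℓ = trans (sym (LP.map-∘ ℓ)) (LP.map-∘ ℓ)

coeffOf : LinearForm k → Fin k → ℤ
coeffOf []            j = 0ℤ
coeffOf ((c , i) ∷ ℓ) j with i ≟ j
... | yes _ = c + coeffOf ℓ j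
... | no _  = coeffOf ℓ j

coeffOf-∷-≡ : ∀ c (ℓ : LinearForm k) j → coeffOf ((c , j) ∷ ℓ) j ≡ c + coeffOf ℓ j
coeffOf-∷-≡ c ℓ j with j ≟ j
... | yes _   = refl
... | no j≢j = contradiction refl j≢j

coeffOf-∷-≢ : ∀ c (ℓ : LinearForm k) → i ≢ j → coeffOf ((c , i) ∷ ℓ) j ≡ coeffOf ℓ j
coeffOf-∷-≢ {i = i} {j} c ℓ i≢j with i ≟ j
... | yes i≡j = contradiction i≡j i≢j
... | no _    = refl

coeffOf-++ : ∀ (ℓ ℓ′ : LinearForm k) j → coeffOf (ℓ L.++ ℓ′) j ≡ coeffOf ℓ j + coeffOf ℓ′ j
coeffOf-++ []            ℓ′ j = sym (ℤP.+-identityˡ _)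
coeffOf-++ ((c , i) ∷ ℓ) ℓ′ j with i ≟ j
... | yes _ = trans (cong (c +_) (coeffOf-++ ℓ ℓ′ j)) (sym (ℤP.+-assoc c _ _))
... | no _  = coeffOf-++ ℓ ℓ′ j

coeffOf-neg : ∀ (ℓ : LinearForm k) j → coeffOf (neg ℓ) j ≡ - coeffOf ℓ j
coeffOf-neg []            j = refl
coeffOf-neg ((c , i) ∷ ℓ) j with i ≟ j
... | yes _ = trans (cong (- c +_) (coeffOf-neg ℓ j)) (sym (ℤP.neg-distrib-+ c _))
... | no _  = coeffOf-neg ℓ j

_⊛_ : LinearForm k → Coefficients k → Coefficients k
([]            ⊛ C) μ = 0ℤ
(((c , i) ∷ ℓ) ⊛ C) μ = c * mulVar i C μ + (ℓ ⊛ C) μ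

coeff-⟦⟧-*P : ∀ (ℓ : LinearForm k) Q μ → coeff (⟦ ℓ ⟧ *P Q) μ ≡ (ℓ ⊛ coeff Q) μ
coeff-⟦⟧-*P []            Q μ = refl
coeff-⟦⟧-*P ((c , i) ∷ ℓ) Q μ = begin
  coeff (⟦ (c , i) ∷ ℓ ⟧ *P Q) μ
    ≡⟨ cong (λ p → coeff p μ) (*P-distribʳ-++ ((c , inc i one) ∷ []) ⟦ ℓ ⟧ Q) ⟩
  coeff ((((c , inc i one) ∷ []) *P Q) L.++ (⟦ ℓ ⟧ *P Q)) μ             ≡⟨ coeff-++ (((c , inc i one) ∷ []) *P Q) _ μ ⟩
  coeff (((c , inc i one) ∷ []) *P Q) μ + coeff (⟦ ℓ ⟧ *P Q) μ
    ≡⟨ cong₂ _+_ (coeff-term-*P c i Q μ) (coeff-⟦⟧-*P ℓ Q μ) ⟩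
  c * mulVar i (coeff Q) μ + (ℓ ⊛ coeff Q) μ                           ∎
  where open ≡-Reasoning

⊛-cong : ∀ (ℓ : LinearForm k) {C C′} → (∀ ν → C ν ≡ C′ ν) → ∀ μ → (ℓ ⊛ C) μ ≡ (ℓ ⊛ C′) μ
⊛-cong []            C≗C′ μ = refl
⊛-cong ((c , i) ∷ ℓ) C≗C′ μ =
  cong₂ (λ x y → c * x + y) (cong (ifPositive (lookup μ i)) (C≗C′ (dec i μ))) (⊛-cong ℓ C≗C′ μ)

⊛-+ : ∀ (ℓ : LinearForm k) C C′ μ → (ℓ ⊛ (λ ν → C ν + C′ ν)) μ ≡ (ℓ ⊛ C) μ + (ℓ ⊛ C′) μ
⊛-+ []            C C′ μ = refl
⊛-+ ((c , i) ∷ ℓ) C C′ μ = begin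
  c * ifPositive (lookup μ i) (C (dec i μ) + C′ (dec i μ)) + (ℓ ⊛ (λ ν → C ν + C′ ν)) μ
    ≡⟨ cong₂ (λ x y → c * x + y) (ifPositive-+ (lookup μ i) _ _) (⊛-+ ℓ C C′ μ) ⟩
  c * (mulVar i C μ + mulVar i C′ μ) + ((ℓ ⊛ C) μ + (ℓ ⊛ C′) μ)
    ≡⟨ rearrange c (mulVar i C μ) (mulVar i C′ μ) _ _ ⟩
  (c * mulVar i C μ + (ℓ ⊛ C) μ) + (c * mulVar i C′ μ + (ℓ ⊛ C′) μ) ∎
  where
  open ≡-Reasoning
  rearrange : ∀ c x x′ y y′ → c * (x + x′) + (y + y′) ≡ (c * x + y) + (c * x′ + y′)
  rearrange = solve-∀

∂-linear : ∀ j c (A B : Coefficients k) μ → ∂ j (λ ν → c * A ν + B ν) μ ≡ c * ∂ j A μ + ∂ j B μ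
∂-linear j c A B μ = distrib (ℤ.+ suc (lookup μ j)) c (A (inc j μ)) (B (inc j μ))
  where
  distrib : ∀ s c a b → s * (c * a + b) ≡ c * (s * a) + s * b
  distrib = solve-∀

∂-⊛ : ∀ (ℓ : LinearForm k) C j μ → ∂ j (ℓ ⊛ C) μ ≡ coeffOf ℓ j * C μ + (ℓ ⊛ ∂ j C) μ
∂-⊛ []            C j μ = s*0≡0*c+0 (ℤ.+ suc (lookup μ j)) (C μ)
  where
  s*0≡0*c+0 : ∀ s c → s * 0ℤ ≡ 0ℤ * c + 0ℤ
  s*0≡0*c+0 = solve-∀
∂-⊛ ((c , i) ∷ ℓ) C j μ with i ≟ j
... | yes refl = begin
  ∂ i (((c , i) ∷ ℓ) ⊛ C) μ                                     ≡⟨ ∂-linear _ c (mulVar i C) (ℓ ⊛ C) μ ⟩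
  c * ∂ i (mulVar i C) μ + ∂ i (ℓ ⊛ C) μ
    ≡⟨ cong₂ (λ x y → c * x + y) (∂-mulVar-≡ i C μ) (∂-⊛ ℓ C i μ) ⟩
  c * (mulVar i (∂ i C) μ + C μ) + (coeffOf ℓ i * C μ + (ℓ ⊛ ∂ i C) μ) ≡⟨ rearrange c _ (C μ) _ _ ⟩
  (c + coeffOf ℓ i) * C μ + (c * mulVar i (∂ i C) μ + (ℓ ⊛ ∂ i C) μ) ∎
  where
  open ≡-Reasoning
  rearrange : ∀ c x y a z → c * (x + y) + (a * y + z) ≡ (c + a) * y + (c * x + z)
  rearrange = solve-∀
... | no i≢j = begin
  ∂ j (((c , i) ∷ ℓ) ⊛ C) μ                                     ≡⟨ ∂-linear _ c (mulVar i C) (ℓ ⊛ C) μ ⟩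
  c * ∂ j (mulVar i C) μ + ∂ j (ℓ ⊛ C) μ
    ≡⟨ cong₂ (λ x y → c * x + y) (∂-mulVar-≢ i≢j C μ) (∂-⊛ ℓ C j μ) ⟩
  c * mulVar i (∂ j C) μ + (coeffOf ℓ j * C μ + (ℓ ⊛ ∂ j C) μ)    ≡⟨ rearrange c _ (coeffOf ℓ j * C μ) _ ⟩
  coeffOf ℓ j * C μ + (c * mulVar i (∂ j C) μ + (ℓ ⊛ ∂ j C) μ)    ∎
  where
  open ≡-Reasoning
  rearrange : ∀ c x a z → c * x + (a + z) ≡ a + (c * x + z)
  rearrange = solve-∀

∂-cong : ∀ j {C C′ : Coefficients k} → (∀ ν → C ν ≡ C′ ν) → ∀ μ → ∂ j C μ ≡ ∂ j C′ μ
∂-cong j C≗C′ μ = cong (ℤ.+ suc (lookup μ j) *_) (C≗C′ (inc j μ))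

∂-const1 : ∀ j (μ : Monomial k) → ∂ j (coeff const1) μ ≡ 0ℤ
∂-const1 j μ = trans (cong (ℤ.+ suc (lookup μ j) *_) coeff-const1) (ℤP.*-zeroʳ (ℤ.+ suc (lookup μ j)))
  where
  coeff-const1 : coeff const1 (inc j μ) ≡ 0ℤ
  coeff-const1 with ≡-dec ℕP._≟_ one (inc j μ)
  ... | yes one≡ = contradiction (sym one≡) (inc≢ (VP.lookup-replicate j 0))
  ... | no _     = refl

product : ∀ {I : Set} → (I → LinearForm k) → List I → Poly k
product ℓ as = prodP (map (⟦_⟧ ∘ ℓ) as)

Balanced : Fin k → Fin k → Fin k → LinearForm k → Set
Balanced x u v ℓ = coeffOf ℓ x ≡ coeffOf ℓ u + coeffOf ℓ v

module _ {x u v : Fin k} where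

  Balanced-++ : ∀ ℓ ℓ′ → Balanced x u v ℓ → Balanced x u v ℓ′ → Balanced x u v (ℓ L.++ ℓ′)
  Balanced-++ ℓ ℓ′ bal bal′ = begin
    coeffOf (ℓ L.++ ℓ′) x                                ≡⟨ coeffOf-++ ℓ ℓ′ x ⟩
    coeffOf ℓ x + coeffOf ℓ′ x                           ≡⟨ cong₂ _+_ bal bal′ ⟩
    (coeffOf ℓ u + coeffOf ℓ v) + (coeffOf ℓ′ u + coeffOf ℓ′ v)
      ≡⟨ rearrange (coeffOf ℓ u) (coeffOf ℓ v) (coeffOf ℓ′ u) (coeffOf ℓ′ v) ⟩
    (coeffOf ℓ u + coeffOf ℓ′ u) + (coeffOf ℓ v + coeffOf ℓ′ v) ≡⟨ cong₂ _+_ (coeffOf-++ ℓ ℓ′ u) (coeffOf-++ ℓ ℓ′ v) ⟨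
    coeffOf (ℓ L.++ ℓ′) u + coeffOf (ℓ L.++ ℓ′) v        ∎
    where
    open ≡-Reasoning
    rearrange : ∀ a b c d → (a + b) + (c + d) ≡ (a + c) + (b + d)
    rearrange = solve-∀

  Balanced-neg : ∀ ℓ → Balanced x u v ℓ → Balanced x u v (neg ℓ)
  Balanced-neg ℓ bal = begin
    coeffOf (neg ℓ) x                        ≡⟨ coeffOf-neg ℓ x ⟩
    - coeffOf ℓ x                            ≡⟨ cong -_ bal ⟩
    - (coeffOf ℓ u + coeffOf ℓ v)            ≡⟨ ℤP.neg-distrib-+ (coeffOf ℓ u) (coeffOf ℓ v) ⟩
    - coeffOf ℓ u + - coeffOf ℓ v            ≡⟨ cong₂ _+_ (coeffOf-neg ℓ u) (coeffOf-neg ℓ v) ⟨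
    coeffOf (neg ℓ) u + coeffOf (neg ℓ) v    ∎
    where open ≡-Reasoning

  Balanced-swap : ∀ ℓ → Balanced x u v ℓ → Balanced x v u ℓ
  Balanced-swap ℓ bal = trans bal (ℤP.+-comm (coeffOf ℓ u) (coeffOf ℓ v))

∂-product-balanced : ∀ {I : Set} {x u v : Fin k} (ℓ : I → LinearForm k) → (∀ a → Balanced x u v (ℓ a)) →
                     ∀ as μ → ∂ x (coeff (product ℓ as)) μ
                            ≡ ∂ u (coeff (product ℓ as)) μ + ∂ v (coeff (product ℓ as)) μ
∂-product-balanced {x = x} {u} {v} ℓ balanced [] μ =
  trans (∂-const1 x μ) (sym (cong₂ _+_ (∂-const1 u μ) (∂-const1 v μ)))
∂-product-balanced {x = x} {u} {v} ℓ balanced (a ∷ as) μ = begin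
  ∂ x C′ μ                                                          ≡⟨ ∂-cong x C′≗ℓC μ ⟩
  ∂ x (ℓ a ⊛ C) μ                                                   ≡⟨ ∂-⊛ (ℓ a) C x μ ⟩
  coeffOf (ℓ a) x * C μ + (ℓ a ⊛ ∂ x C) μ
    ≡⟨ cong₂ (λ y z → y * C μ + z) (balanced a) (⊛-cong (ℓ a) (∂-product-balanced ℓ balanced as) μ) ⟩
  (coeffOf (ℓ a) u + coeffOf (ℓ a) v) * C μ + (ℓ a ⊛ (λ ν → ∂ u C ν + ∂ v C ν)) μ
    ≡⟨ cong ((coeffOf (ℓ a) u + coeffOf (ℓ a) v) * C μ +_) (⊛-+ (ℓ a) (∂ u C) (∂ v C) μ) ⟩
  (coeffOf (ℓ a) u + coeffOf (ℓ a) v) * C μ + ((ℓ a ⊛ ∂ u C) μ + (ℓ a ⊛ ∂ v C) μ)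
    ≡⟨ rearrange (coeffOf (ℓ a) u) (coeffOf (ℓ a) v) (C μ) _ _ ⟩
  (coeffOf (ℓ a) u * C μ + (ℓ a ⊛ ∂ u C) μ) + (coeffOf (ℓ a) v * C μ + (ℓ a ⊛ ∂ v C) μ)
    ≡⟨ cong₂ _+_ (∂-⊛ (ℓ a) C u μ) (∂-⊛ (ℓ a) C v μ) ⟨
  ∂ u (ℓ a ⊛ C) μ + ∂ v (ℓ a ⊛ C) μ                                 ≡⟨ cong₂ _+_ (∂-cong u C′≗ℓC μ) (∂-cong v C′≗ℓC μ) ⟨
  ∂ u C′ μ + ∂ v C′ μ                                               ∎
  where
  open ≡-Reasoning
  C C′ : Coefficients _
  C  = coeff (product ℓ as)
  C′ = coeff (product ℓ (a ∷ as))
  C′≗ℓC : ∀ ν → C′ ν ≡ (ℓ a ⊛ C) ν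
  C′≗ℓC = coeff-⟦⟧-*P (ℓ a) (product ℓ as)
  rearrange : ∀ p q c y z → (p + q) * c + (y + z) ≡ (p * c + y) + (q * c + z)
  rearrange = solve-∀

nonzero-neighbour : ∀ {x u v : Fin k} (C : Coefficients k) → (∀ μ → ∂ x C μ ≡ ∂ u C μ + ∂ v C μ) →
                    ∀ b → C (inc v b) ≢ 0ℤ → C (inc x b) ≢ 0ℤ ⊎ C (inc u b) ≢ 0ℤ
nonzero-neighbour {x = x} {u} {v} C euler b Cv≢0 with C (inc x b) ℤ.≟ 0ℤ
... | no Cx≢0  = inj₁ Cx≢0
... | yes Cx≡0 = inj₂ λ Cu≡0 → Cv≢0 (Cv≡0 Cu≡0)
  where
  ∂≡0 : ∀ j → C (inc j b) ≡ 0ℤ → ∂ j C b ≡ 0ℤ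
  ∂≡0 j Cj≡0 = trans (cong (ℤ.+ suc (lookup b j) *_) Cj≡0) (ℤP.*-zeroʳ (ℤ.+ suc (lookup b j)))
  Cv≡0 : C (inc u b) ≡ 0ℤ → C (inc v b) ≡ 0ℤ
  Cv≡0 Cu≡0 with ℤP.i*j≡0⇒i≡0∨j≡0 (ℤ.+ suc (lookup b v)) (begin
    ∂ v C b               ≡⟨ ℤP.+-identityˡ (∂ v C b) ⟨
    0ℤ + ∂ v C b          ≡⟨ cong (_+ ∂ v C b) (∂≡0 u Cu≡0) ⟨
    ∂ u C b + ∂ v C b     ≡⟨ euler b ⟨
    ∂ x C b               ≡⟨ ∂≡0 x Cx≡0 ⟩
    0ℤ                    ∎)
    where open ≡-Reasoning
  ... | inj₂ Cv≡0 = Cv≡0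

-- Leading terms

module _ (ω : Fin k → ℕ) where

  Led : LinearForm k → Fin k → Set
  Led ℓ j = All (λ t → proj₂ t ≡ j ⊎ ω j < ω (proj₂ t)) ℓ

  VanishesBelow : ℕ → Coefficients k → Set
  VanishesBelow W C = ∀ μ → weight ω μ < W → C μ ≡ 0ℤ

  mulVar-vanishes : ∀ {W C} i μ → VanishesBelow W C → weight ω μ < ω i ℕ.+ W → mulVar i C μ ≡ 0ℤ
  mulVar-vanishes i μ vanish μ<ωi+W with lookup μ i in μi
  ... | zero  = refl
  ... | suc t = vanish (dec i μ) (ℕP.+-cancelˡ-< (ω i) _ _ (begin-strict
    ω i ℕ.+ weight ω (dec i μ) ≡⟨ weight-inc ω i (dec i μ) ⟨
    weight ω (inc i (dec i μ)) ≡⟨ cong (weight ω) (inc-dec i μ μi) ⟩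
    weight ω μ                 <⟨ μ<ωi+W ⟩
    ω i ℕ.+ _                  ∎))
    where open ℕP.≤-Reasoning

  ⊛-vanishes : ∀ {W C j} (ℓ : LinearForm k) → All (λ t → ω j ≤ ω (proj₂ t)) ℓ →
               VanishesBelow W C → VanishesBelow (ω j ℕ.+ W) (ℓ ⊛ C)
  ⊛-vanishes []            []             vanish μ lt = refl
  ⊛-vanishes {W} ((c , i) ∷ ℓ) (ωj≤ωi ∷ ωj≤ℓ) vanish μ lt =
    trans (cong₂ (λ x y → c * x + y)
                 (mulVar-vanishes i μ vanish (ℕP.<-≤-trans lt (ℕP.+-monoˡ-≤ W ωj≤ωi)))
                 (⊛-vanishes ℓ ωj≤ℓ vanish μ lt))
          (cong (_+ 0ℤ) (ℤP.*-zeroʳ c))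

  ⊛-leading : ∀ {j γ C} (ℓ : LinearForm k) → Led ℓ j → VanishesBelow (weight ω γ) C →
              (ℓ ⊛ C) (inc j γ) ≡ coeffOf ℓ j * C γ
  ⊛-leading {γ = γ} {C} [] [] vanish = sym (ℤP.*-zeroˡ (C γ))
  ⊛-leading {j} {γ} {C} ((c , .j) ∷ ℓ) (inj₁ refl ∷ led) vanish = begin
    c * mulVar j C (inc j γ) + (ℓ ⊛ C) (inc j γ) ≡⟨ cong₂ (λ x y → c * x + y) mulVar-leading (⊛-leading ℓ led vanish) ⟩
    c * C γ + coeffOf ℓ j * C γ                  ≡⟨ ℤP.*-distribʳ-+ (C γ) c (coeffOf ℓ j) ⟨
    (c + coeffOf ℓ j) * C γ                      ≡⟨ cong (_* C γ) (coeffOf-∷-≡ c ℓ j) ⟨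
    coeffOf ((c , j) ∷ ℓ) j * C γ                ∎
    where
    open ≡-Reasoning
    mulVar-leading : mulVar j C (inc j γ) ≡ C γ
    mulVar-leading = trans (mulVar-suc j C (inc j γ) (VP.lookup∘updateAt j γ)) (cong C (dec-inc j γ))
  ⊛-leading {j} {γ} {C} ((c , i) ∷ ℓ) (inj₂ ωj<ωi ∷ led) vanish = begin
    c * mulVar i C (inc j γ) + (ℓ ⊛ C) (inc j γ) ≡⟨ cong₂ (λ x y → c * x + y) mulVar-trailing (⊛-leading ℓ led vanish) ⟩
    c * 0ℤ + coeffOf ℓ j * C γ                   ≡⟨ cong (_+ coeffOf ℓ j * C γ) (ℤP.*-zeroʳ c) ⟩
    0ℤ + coeffOf ℓ j * C γ                       ≡⟨ ℤP.+-identityˡ _ ⟩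
    coeffOf ℓ j * C γ                            ≡⟨ cong (_* C γ) (coeffOf-∷-≢ c ℓ i≢j) ⟨
    coeffOf ((c , i) ∷ ℓ) j * C γ                ∎
    where
    open ≡-Reasoning
    i≢j : i ≢ j
    i≢j refl = ℕP.<-irrefl refl ωj<ωi
    mulVar-trailing : mulVar i C (inc j γ) ≡ 0ℤ
    mulVar-trailing = mulVar-vanishes i (inc j γ) vanish
      (subst (_< ω i ℕ.+ weight ω γ) (sym (weight-inc ω j γ)) (ℕP.+-monoˡ-< (weight ω γ) ωj<ωi))

  module _ {I : Set} (ℓ : I → LinearForm k) (lead : I → Fin k) (led : ∀ a → Led (ℓ a) (lead a)) where

    product-vanishes : ∀ as → VanishesBelow (weight ω (monomialOf (map lead as))) (coeff (product ℓ as))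
    product-vanishes []       μ μ<0 = contradiction (subst (weight ω μ <_) (weight-one ω) μ<0) ℕP.n≮0
    product-vanishes (a ∷ as) μ μ<W =
      trans (coeff-⟦⟧-*P (ℓ a) (product ℓ as) μ)
            (⊛-vanishes {j = lead a} (ℓ a) (All.map (λ {t} → weaken {t}) (led a)) (product-vanishes as) μ
                        (subst (weight ω μ <_) (weight-inc ω (lead a) (monomialOf (map lead as))) μ<W))
      where
      weaken : ∀ {t : ℤ × Fin k} → proj₂ t ≡ lead a ⊎ ω (lead a) < ω (proj₂ t) → ω (lead a) ≤ ω (proj₂ t)
      weaken (inj₁ refl) = ℕP.≤-refl
      weaken (inj₂ lt)   = ℕP.<⇒≤ lt

    product-leading : (∀ a → coeffOf (ℓ a) (lead a) ≢ 0ℤ) → ∀ as → coeff (product ℓ as) (monomialOf (map lead as)) ≢ 0ℤ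
    product-leading lead≢0 [] with ≡-dec ℕP._≟_ (one {k}) one
    ... | yes _   = λ ()
    ... | no one≢ = contradiction refl one≢
    product-leading lead≢0 (a ∷ as) coeff≡0
      with ℤP.i*j≡0⇒i≡0∨j≡0 (coeffOf (ℓ a) (lead a)) (begin
        coeffOf (ℓ a) (lead a) * coeff (product ℓ as) γ ≡⟨ ⊛-leading (ℓ a) (led a) (product-vanishes as) ⟨
        (ℓ a ⊛ coeff (product ℓ as)) (inc (lead a) γ)   ≡⟨ coeff-⟦⟧-*P (ℓ a) (product ℓ as) _ ⟨
        coeff (product ℓ (a ∷ as)) (inc (lead a) γ)     ≡⟨ coeff≡0 ⟩
        0ℤ                                              ∎)
      where
      open ≡-Reasoning
      γ : Monomial k
      γ = monomialOf (map lead as)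
    ... | inj₁ lead≡0 = lead≢0 a lead≡0
    ... | inj₂ rest≡0 = product-leading lead≢0 as rest≡0

-- The factors of P_G

module _ (G : Graph) where

  vtx : Vertex G → Fin (NVars G)
  vtx w = w ↑ˡ m G

  edg : Edge G → Fin (NVars G)
  edg e = n G ↑ʳ e

  end₁ end₂ : Edge G → Vertex G
  end₁ e = proj₁ (ends G e)
  end₂ e = proj₂ (ends G e)

  Incident : Vertex G → Edge G → Set
  Incident a e = a ≡ end₁ e ⊎ a ≡ end₂ e

  vtx<edg : ∀ w e → toℕ (vtx w) < toℕ (edg e)
  vtx<edg w e = begin-strict
    toℕ (w ↑ˡ m G)       ≡⟨ FP.toℕ-↑ˡ w (m G) ⟩
    toℕ w                <⟨ FP.toℕ<n w ⟩
    n G                  ≤⟨ ℕP.m≤m+n (n G) (toℕ e) ⟩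
    n G ℕ.+ toℕ e        ≡⟨ FP.toℕ-↑ʳ (n G) e ⟨
    toℕ (n G ↑ʳ e)       ∎
    where open ℕP.≤-Reasoning

  vtx≢edg : ∀ {w e} → vtx w ≢ edg e
  vtx≢edg {w} {e} eq = ℕP.<⇒≢ (vtx<edg w e) (cong toℕ eq)

  edgeTerms : List (Edge G) → LinearForm (NVars G)
  edgeTerms = map (λ g → (1ℤ , edg g))

  vertexForm : Vertex G → LinearForm (NVars G)
  vertexForm a = edgeTerms (E G a) L.++ (1ℤ , vtx a) ∷ []

  factorForm : Edge G → LinearForm (NVars G)
  factorForm e = vertexForm (end₁ e) L.++ neg (vertexForm (end₂ e))

  L≡⟦vertexForm⟧ : ∀ a → L G a ≡ ⟦ vertexForm a ⟧
  L≡⟦vertexForm⟧ a = trans (cong₂ L._++_ (sum≡ (E G a)) (var≡ (vtx a))) (sym (LP.map-++ _ (edgeTerms (E G a)) _))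
    where
    sum≡ : ∀ xs → sumP (map (xE G) xs) ≡ ⟦ edgeTerms xs ⟧
    sum≡ []       = refl
    sum≡ (g ∷ xs) = cong₂ L._++_ (var≡ (edg g)) (sum≡ xs)

  P≡product : P G ≡ product factorForm (allFin (m G))
  P≡product = cong prodP (LP.map-cong factor≡ (allFin (m G)))
    where
    factor≡ : ∀ e → L G (end₁ e) -P L G (end₂ e) ≡ ⟦ factorForm e ⟧
    factor≡ e = begin
      L G (end₁ e) -P L G (end₂ e)
        ≡⟨ cong₂ _-P_ (L≡⟦vertexForm⟧ (end₁ e)) (L≡⟦vertexForm⟧ (end₂ e)) ⟩
      ⟦ vertexForm (end₁ e) ⟧ L.++ (-P ⟦ vertexForm (end₂ e) ⟧)
        ≡⟨ cong (⟦ vertexForm (end₁ e) ⟧ L.++_) (⟦neg⟧ (vertexForm (end₂ e))) ⟩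
      ⟦ vertexForm (end₁ e) ⟧ L.++ ⟦ neg (vertexForm (end₂ e)) ⟧ ≡⟨ LP.map-++ _ (vertexForm (end₁ e)) _ ⟨
      ⟦ factorForm e ⟧                                        ∎
      where open ≡-Reasoning

  coeffOf-edgeTerms-vtx : ∀ xs w → coeffOf (edgeTerms xs) (vtx w) ≡ 0ℤ
  coeffOf-edgeTerms-vtx []       w = refl
  coeffOf-edgeTerms-vtx (g ∷ xs) w = trans (coeffOf-∷-≢ 1ℤ _ (vtx≢edg ∘ sym)) (coeffOf-edgeTerms-vtx xs w)

  coeffOf-edgeTerms-∉ : ∀ {xs e} → All (_≢ e) xs → coeffOf (edgeTerms xs) (edg e) ≡ 0ℤ
  coeffOf-edgeTerms-∉ []            = refl
  coeffOf-edgeTerms-∉ (g≢e ∷ ≢e) =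
    trans (coeffOf-∷-≢ 1ℤ _ (g≢e ∘ FP.↑ʳ-injective (n G) _ _)) (coeffOf-edgeTerms-∉ ≢e)

  coeffOf-edgeTerms-∈ : ∀ {xs e} → Unique xs → e ∈ xs → coeffOf (edgeTerms xs) (edg e) ≡ 1ℤ
  coeffOf-edgeTerms-∈ {e ∷ xs} (e∉xs ∷ _) (here refl) =
    trans (coeffOf-∷-≡ 1ℤ _ (edg e)) (cong (1ℤ +_) (coeffOf-edgeTerms-∉ (All.map (_∘ sym) e∉xs)))
  coeffOf-edgeTerms-∈ {g ∷ xs} (g∉xs ∷ unique) (there e∈xs) =
    trans (coeffOf-∷-≢ 1ℤ _ (g≢e ∘ FP.↑ʳ-injective (n G) _ _)) (coeffOf-edgeTerms-∈ unique e∈xs)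
    where
    g≢e : g ≢ _
    g≢e = All.lookup g∉xs e∈xs

  vertexForm-vtx : ∀ a w → coeffOf (vertexForm a) (vtx w) ≡ coeffOf ((1ℤ , vtx a) ∷ []) (vtx w)
  vertexForm-vtx a w =
    trans (coeffOf-++ (edgeTerms (E G a)) _ (vtx w))
          (trans (cong (_+ coeffOf ((1ℤ , vtx a) ∷ []) (vtx w)) (coeffOf-edgeTerms-vtx (E G a) w)) (ℤP.+-identityˡ _))

  vertexForm-vtx-≡ : ∀ a → coeffOf (vertexForm a) (vtx a) ≡ 1ℤ
  vertexForm-vtx-≡ a = trans (vertexForm-vtx a a) (coeffOf-∷-≡ 1ℤ [] (vtx a))

  vertexForm-vtx-≢ : ∀ {a w} → a ≢ w → coeffOf (vertexForm a) (vtx w) ≡ 0ℤ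
  vertexForm-vtx-≢ {a} {w} a≢w =
    trans (vertexForm-vtx a w) (coeffOf-∷-≢ 1ℤ [] (a≢w ∘ FP.↑ˡ-injective (m G) a w))

  vertexForm-edg : ∀ a e → coeffOf (vertexForm a) (edg e) ≡ coeffOf (edgeTerms (E G a)) (edg e)
  vertexForm-edg a e =
    trans (coeffOf-++ (edgeTerms (E G a)) _ (edg e))
          (trans (cong (coeffOf (edgeTerms (E G a)) (edg e) +_) (coeffOf-∷-≢ 1ℤ [] (vtx≢edg {a} {e}))) (ℤP.+-identityʳ _))

  vertexForm-incident : ∀ {a e} → Incident a e → coeffOf (vertexForm a) (edg e) ≡ 1ℤ
  vertexForm-incident {a} {e} a~e = trans (vertexForm-edg a e)
    (coeffOf-edgeTerms-∈ (UniqueP.filter⁺ (incident? G a) (UniqueP.allFin⁺ (m G)))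
                         (∈-filter⁺ (incident? G a) (∈-allFin e) a~e))

  vertexForm-nonincident : ∀ {a e} → ¬ Incident a e → coeffOf (vertexForm a) (edg e) ≡ 0ℤ
  vertexForm-nonincident {a} {e} a≁e = trans (vertexForm-edg a e)
    (coeffOf-edgeTerms-∉ (All.map (λ a~g g≡e → a≁e (subst (Incident a) g≡e a~g))
                                  (AllP.all-filter (incident? G a) (allFin (m G)))))

  vertexForm-balanced : ∀ a e → Balanced (edg e) (vtx (end₁ e)) (vtx (end₂ e)) (vertexForm a)
  vertexForm-balanced a e with a ≟ end₁ e | a ≟ end₂ e
  ... | yes refl | yes a≡end₂ = contradiction a≡end₂ (loopless G e)
  ... | yes refl | no a≢end₂  = begin
    coeffOf (vertexForm a) (edg e)                                            ≡⟨ vertexForm-incident (inj₁ refl) ⟩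
    1ℤ + 0ℤ
      ≡⟨ cong₂ _+_ (vertexForm-vtx-≡ a) (vertexForm-vtx-≢ a≢end₂) ⟨
    coeffOf (vertexForm a) (vtx (end₁ e)) + coeffOf (vertexForm a) (vtx (end₂ e)) ∎
    where open ≡-Reasoning
  ... | no a≢end₁ | yes refl = begin
    coeffOf (vertexForm a) (edg e)                                            ≡⟨ vertexForm-incident (inj₂ refl) ⟩
    0ℤ + 1ℤ
      ≡⟨ cong₂ _+_ (vertexForm-vtx-≢ a≢end₁) (vertexForm-vtx-≡ a) ⟨
    coeffOf (vertexForm a) (vtx (end₁ e)) + coeffOf (vertexForm a) (vtx (end₂ e)) ∎
    where open ≡-Reasoning
  ... | no a≢end₁ | no a≢end₂ = begin
    coeffOf (vertexForm a) (edg e)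
      ≡⟨ vertexForm-nonincident [ a≢end₁ , a≢end₂ ]′ ⟩
    0ℤ + 0ℤ
      ≡⟨ cong₂ _+_ (vertexForm-vtx-≢ a≢end₁) (vertexForm-vtx-≢ a≢end₂) ⟨
    coeffOf (vertexForm a) (vtx (end₁ e)) + coeffOf (vertexForm a) (vtx (end₂ e)) ∎
    where open ≡-Reasoning

  factorForm-balanced : ∀ f e → Balanced (edg e) (vtx (end₁ e)) (vtx (end₂ e)) (factorForm f)
  factorForm-balanced f e =
    Balanced-++ (vertexForm (end₁ f)) _ (vertexForm-balanced (end₁ f) e)
                (Balanced-neg (vertexForm (end₂ f)) (vertexForm-balanced (end₂ f) e))

  factorForm-balanced-oriented : ∀ (D : Orientation G) f e →
                                 Balanced (edg e) (vtx (tail G D e)) (vtx (head G D e)) (factorForm f)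
  factorForm-balanced-oriented D f e with D e
  ... | false = factorForm-balanced f e
  ... | true  = Balanced-swap (factorForm f) (factorForm-balanced f e)

  lowerEnd : Edge G → Vertex G
  lowerEnd e with FP.≤-total (end₁ e) (end₂ e)
  ... | inj₁ _ = end₁ e
  ... | inj₂ _ = end₂ e

  lowerEnd-incident : ∀ e → Incident (lowerEnd e) e
  lowerEnd-incident e with FP.≤-total (end₁ e) (end₂ e)
  ... | inj₁ _ = inj₁ refl
  ... | inj₂ _ = inj₂ refl

  lowerEnd-≤ : ∀ e → lowerEnd e F.≤ end₁ e × lowerEnd e F.≤ end₂ e
  lowerEnd-≤ e with FP.≤-total (end₁ e) (end₂ e)
  ... | inj₁ end₁≤end₂ = FP.≤-refl , end₁≤end₂
  ... | inj₂ end₂≤end₁ = end₂≤end₁ , FP.≤-refl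

  vertexForm-led : ∀ {a w} → w F.≤ a → Led toℕ (vertexForm a) (vtx w)
  vertexForm-led {a} {w} w≤a =
    AllP.++⁺ (AllP.map⁺ (All.universal (λ g → inj₂ (vtx<edg w g)) (E G a))) (vertexTerm ∷ [])
    where
    vertexTerm : vtx a ≡ vtx w ⊎ toℕ (vtx w) < toℕ (vtx a)
    vertexTerm with ℕP.m≤n⇒m<n∨m≡n w≤a
    ... | inj₁ w<a = inj₂ (subst₂ _<_ (sym (FP.toℕ-↑ˡ w (m G))) (sym (FP.toℕ-↑ˡ a (m G))) w<a)
    ... | inj₂ w≡a = inj₁ (cong vtx (sym (FP.toℕ-injective w≡a)))

  factorForm-led : ∀ f → Led toℕ (factorForm f) (vtx (lowerEnd f))
  factorForm-led f = AllP.++⁺ (vertexForm-led (proj₁ (lowerEnd-≤ f))) (AllP.map⁺ (vertexForm-led (proj₂ (lowerEnd-≤ f))))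

  factorForm-vtx : ∀ f w → coeffOf (factorForm f) (vtx w)
                           ≡ coeffOf (vertexForm (end₁ f)) (vtx w) + - coeffOf (vertexForm (end₂ f)) (vtx w)
  factorForm-vtx f w = trans (coeffOf-++ (vertexForm (end₁ f)) _ (vtx w))
                             (cong (coeffOf (vertexForm (end₁ f)) (vtx w) +_) (coeffOf-neg (vertexForm (end₂ f)) (vtx w)))

  factorForm-lead≢0 : ∀ f → coeffOf (factorForm f) (vtx (lowerEnd f)) ≢ 0ℤ
  factorForm-lead≢0 f = lead≢0 (lowerEnd-incident f)
    where
    open ≡-Reasoning
    lead≢0 : ∀ {w} → Incident w f → coeffOf (factorForm f) (vtx w) ≢ 0ℤ
    lead≢0 (inj₁ refl) coeff≡0 = contradiction (begin
      1ℤ + - 0ℤ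
        ≡⟨ cong₂ (λ x y → x + - y) (vertexForm-vtx-≡ (end₁ f)) (vertexForm-vtx-≢ (loopless G f ∘ sym)) ⟨
      _                                         ≡⟨ factorForm-vtx f (end₁ f) ⟨
      coeffOf (factorForm f) (vtx (end₁ f))     ≡⟨ coeff≡0 ⟩
      0ℤ                                        ∎) λ ()
    lead≢0 (inj₂ refl) coeff≡0 = contradiction (begin
      0ℤ + - 1ℤ
        ≡⟨ cong₂ (λ x y → x + - y) (vertexForm-vtx-≢ (loopless G f)) (vertexForm-vtx-≡ (end₂ f)) ⟨
      _                                         ≡⟨ factorForm-vtx f (end₂ f) ⟨
      coeffOf (factorForm f) (vtx (end₂ f))     ≡⟨ coeff≡0 ⟩
      0ℤ                                        ∎) λ ()

  -- Choosing one variable per factor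

  Choice : Set
  Choice = Vector (Fin (NVars G)) (m G)

  monomialOfChoice : Choice → Monomial (NVars G)
  monomialOfChoice c = monomialOf (map c (allFin (m G)))

  monomialOfChoice-focus : ∀ (c c′ : Choice) e → (∀ x → x ≢ e → c′ x ≡ c x) →
                           monomialOfChoice c′ ≡ inc (c′ e) (monomialOf (map c (without e (allFin (m G)))))
  monomialOfChoice-focus c c′ e = monomialOf-focus c c′ (UniqueP.allFin⁺ (m G)) (∈-allFin e)

  coeffP≡ : ∀ μ → coeff (P G) μ ≡ coeff (product factorForm (allFin (m G))) μ
  coeffP≡ μ = cong (λ p → coeff p μ) P≡product

  module _ (D : Orientation G) where

    Good : Edge G → Fin (NVars G) → Set
    Good e j = j ≡ vtx (tail G D e) ⊎ j ≡ edg e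

    improve : ∀ c e → c e ≡ vtx (head G D e) → coeff (P G) (monomialOfChoice c) ≢ 0ℤ →
              Σ (Fin (NVars G)) λ j → Good e j × coeff (P G) (monomialOfChoice (VF.updateAt c e (const j))) ≢ 0ℤ
    improve c e ce≡head c≢0 = [ (λ Cedge≢0 → edg e , inj₂ refl , Cedge≢0 ∘ trans (sym (updated (edg e))))
                              , (λ Ctail≢0 → vtx (tail G D e) , inj₁ refl , Ctail≢0 ∘ trans (sym (updated (vtx (tail G D e)))))
                              ]′ (nonzero-neighbour C euler b Chead≢0)
      where
      C : Coefficients (NVars G)
      C = coeff (product factorForm (allFin (m G)))
      euler : ∀ μ → ∂ (edg e) C μ ≡ ∂ (vtx (tail G D e)) C μ + ∂ (vtx (head G D e)) C μ
      euler = ∂-product-balanced factorForm (λ f → factorForm-balanced-oriented D f e) (allFin (m G))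
      b : Monomial (NVars G)
      b = monomialOf (map c (without e (allFin (m G))))
      Chead≢0 : C (inc (vtx (head G D e)) b) ≢ 0ℤ
      Chead≢0 = c≢0 ∘ trans (trans (cong (coeff (P G)) (trans (monomialOfChoice-focus c c e (λ _ _ → refl))
                                                                (cong (λ j → inc j b) ce≡head)))
                                   (coeffP≡ _))
      updated : ∀ j → coeff (P G) (monomialOfChoice (VF.updateAt c e (const j))) ≡ C (inc j b)
      updated j = trans (cong (coeff (P G)) (trans (monomialOfChoice-focus c _ e (λ x x≢e → VFP.updateAt-minimal x e c x≢e))
                                                   (cong (λ j′ → inc j′ b) (VFP.updateAt-updates e c))))
                        (coeffP≡ _)

    Pending : List (Edge G) → Choice → Set
    Pending es c = ∀ x → Good x (c x) ⊎ (c x ≡ vtx (head G D x) × x ∈ es)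

    descend : ∀ es c → Pending es c → coeff (P G) (monomialOfChoice c) ≢ 0ℤ →
              Σ Choice λ c′ → (∀ x → Good x (c′ x)) × coeff (P G) (monomialOfChoice c′) ≢ 0ℤ
    descend []       c pending c≢0 = c , (λ x → [ (λ good → good) , (λ { (_ , ()) }) ]′ (pending x)) , c≢0
    descend (e ∷ es) c pending c≢0 with pending e
    ... | inj₁ good-e = descend es c pending′ c≢0
      where
      pending′ : Pending es c
      pending′ x with pending x
      ... | inj₁ good                  = inj₁ good
      ... | inj₂ (_ , here refl)       = inj₁ good-e
      ... | inj₂ (at-head , there x∈es) = inj₂ (at-head , x∈es)
    ... | inj₂ (at-head , _) with improve c e at-head c≢0
    ...   | j , good-j , c′≢0 = descend es c′ pending′ c′≢0
      where
      c′ : Choice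
      c′ = VF.updateAt c e (const j)
      pending′ : Pending es c′
      pending′ x with x ≟ e
      ... | yes refl = inj₁ (subst (Good x) (sym (VFP.updateAt-updates x c)) good-j)
      ... | no x≢e   = subst (λ y → Good x y ⊎ (y ≡ vtx (head G D x) × x ∈ es)) (sym (VFP.updateAt-minimal x e c x≢e))
                             (Sum.map₂ (map₂ drop-head) (pending x))
        where
        drop-head : x ∈ e ∷ es → x ∈ es
        drop-head (here x≡e)   = contradiction x≡e x≢e
        drop-head (there x∈es) = x∈es

    incident-tail-or-head : ∀ {w e} → Incident w e → w ≡ tail G D e ⊎ w ≡ head G D e
    incident-tail-or-head {e = e} w~e with D e
    ... | false = w~e
    ... | true  = Sum.swap w~e

    initial : Choice
    initial = vtx ∘ lowerEnd

    initial-pending : Pending (allFin (m G)) initial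
    initial-pending x with incident-tail-or-head (lowerEnd-incident x)
    ... | inj₁ lower≡tail = inj₁ (inj₁ (cong vtx lower≡tail))
    ... | inj₂ lower≡head = inj₂ (cong vtx lower≡head , ∈-allFin x)

    initial≢0 : coeff (P G) (monomialOfChoice initial) ≢ 0ℤ
    initial≢0 = product-leading toℕ factorForm (vtx ∘ lowerEnd) factorForm-led factorForm-lead≢0 (allFin (m G))
              ∘ trans (sym (coeffP≡ _))

    indexFunctionOf : Choice → IndexFunction G
    indexFunctionOf c z = lookup (monomialOfChoice c) (F.join (n G) (m G) z)

    monomial-indexFunctionOf : ∀ c → monomial G (indexFunctionOf c) ≡ monomialOfChoice c
    monomial-indexFunctionOf c =
      trans (VP.tabulate-cong (cong (lookup (monomialOfChoice c)) ∘ FP.join-splitAt (n G) (m G)))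
            (VP.tabulate∘lookup (monomialOfChoice c))

    indexFunctionOf-valid : ∀ c → Valid G (indexFunctionOf c)
    indexFunctionOf-valid c = begin
      total G (indexFunctionOf c)      ≡⟨ sum-split (n G) (monomialOfChoice c) ⟩
      V.sum (monomialOfChoice c)       ≡⟨ sum-monomialOf (map c (allFin (m G))) ⟩
      L.length (map c (allFin (m G)))  ≡⟨ LP.length-map c (allFin (m G)) ⟩
      L.length (allFin (m G))          ≡⟨ LP.length-tabulate (λ x → x) ⟩
      m G                              ∎
      where open ≡-Reasoning

    indexFunctionOf-≤ : ∀ c → (∀ x → Good x (c x)) → _≤ᶠ_ {G} (indexFunctionOf c) (ηD G D)
    indexFunctionOf-≤ c good (inj₁ v) = lookup-monomialOf-≤ c (λ e → v ≟ tail G D e) picks-v (allFin (m G))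
      where
      picks-v : ∀ x → c x ≡ vtx v → v ≡ tail G D x
      picks-v x cx≡v with good x
      ... | inj₁ cx≡tail = FP.↑ˡ-injective (m G) v _ (trans (sym cx≡v) cx≡tail)
      ... | inj₂ cx≡edg  = contradiction (trans (sym cx≡v) cx≡edg) vtx≢edg
    indexFunctionOf-≤ c good (inj₂ e) = begin
      lookup (monomialOfChoice c) (edg e)
        ≡⟨ cong (λ μ → lookup μ (edg e)) (monomialOfChoice-focus c c e (λ _ _ → refl)) ⟩
      lookup (inc (c e) others) (edg e)           ≤⟨ lookup-inc-≤ (c e) (edg e) others ⟩
      suc (lookup others (edg e))
        ≡⟨ cong suc (lookup-monomialOf-≡0 c (All.map others-avoid (AllP.all-filter _ (allFin (m G))))) ⟩
      1                                           ∎
      where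
      open ℕP.≤-Reasoning
      others : Monomial (NVars G)
      others = monomialOf (map c (without e (allFin (m G))))
      others-avoid : ∀ {x} → ¬ x ≡ e → c x ≢ edg e
      others-avoid {x} x≢e cx≡e with good x
      ... | inj₁ cx≡tail = vtx≢edg (trans (sym cx≡tail) cx≡e)
      ... | inj₂ cx≡edg  = x≢e (FP.↑ʳ-injective (n G) x e (trans (sym cx≡edg) cx≡e))

lemma15 : (G : Graph) (D : Orientation G) → NonSingular G (ηD G D)
lemma15 G D with descend G D (allFin (m G)) (initial G D) (initial-pending G D) (initial≢0 G D)
... | c , good , c≢0 =
  indexFunctionOf G D c , indexFunctionOf-≤ G D c good , indexFunctionOf-valid G D c ,
  c≢0 ∘ trans (cong (coeff (P G)) (sym (monomial-indexFunctionOf G D c)))
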